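{- Let $X$ be a finite set with $|X| = n \ge 2$ and let $\mathcal{F}$ be a family of subsets of $X$. For $x\in X$ let $H_x=\{F\in\mathcal{F}: x\in F\}$, and let $\mathcal{H}=(H_x)_{x\in X}$ be the dual of $\mathcal{F}$. Then $\mathcal{F}$ solves Model 1 if and only if $\mathcal{H}$ is a 2-Sperner family of cardinality $|X|$, i.e. the sets $H_x$ ($x\in X$) are pairwise distinct and there are no three distinct elements $x,y,z\in X$ with $H_x\subsetneq H_y\subsetneq H_z$. Consequently, $$f_1(n)=\min\Big\{m:\ \binom{m}{\lfloor m/2\rfloor}+\binom{m}{\lfloor m/2+1\rfloor}\ge n\Big\}.$$
   Context: Model 1 (non-adaptive search with four players $A,B,C,D$). There is an unknown defective element $d$ in an $n$-element set $X$, chosen by Player $A$. Player $B$ chooses, all at once, a family $\mathcal{F}$ of subsets of $X$ (the queries; a query $F$ asks whether $d\in F$). Players $C$ and $D$ have no information about $\mathcal{F}$ beforehand: Player $C$ is given only the subfamily $\{F\in\mathcal{F}: d\in F\}$ (the YES answers together with the corresponding sets), and Player $D$ is given only the subfamily $\{F\in\mathcal{F}: d\notin F\}$ (the NO answers together with the corresponding sets). Player $C$ can identify $d$ iff $d$ is the unique element of $X$ lying in every set given to $C$; Player $D$ can identify $d$ iff $d$ is the unique element of $X$ lying in no set given to $D$. The family $\mathcal{F}$ solves Model 1 if for every possible choice of $d\in X$, at least one of $C$ and $D$ can identify $d$. $f_1(n)$ denotes the minimum of $|\mathcal{F}|$ over families $\mathcal{F}$ on an $n$-element set that solve Model 1.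 -}

module Defs where

open import Data.Nat using (ℕ; _≤_; _+_; _/_)
open import Data.Nat.Combinatorics using (_C_)
open import Data.Fin using (Fin)
open import Data.Fin.Subset using (Subset; _∈_; _∉_; _⊂_)
open import Data.Vec using (tabulate; lookup)
open import Data.Product using (Σ; ∃; _×_)
open import Data.Sum using (_⊎_)
open import Relation.Binary.PropositionalEquality using (_≡_; _≢_)
open import Relation.Nullary using (¬_)
open import Function.Definitions using (Injective)

-- A family of m subsets of X = Fin n, given as an indexed list of
-- queries F 0, …, F (m-1).  A *family* (a set of subsets) is
-- required to have pairwise distinct members, so |𝓕| = m.
Queries : ℕ → ℕ → Set
Queries n m = Fin m → Subset n

IsFamily : ∀ {n m} → Queries n m → Set
IsFamily F = Injective _≡_ _≡_ F

-- Player C (given the YES sets {F ∈ 𝓕 : d ∈ F}) identifies d iff d is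
-- the unique element lying in every set given to C.
CIdentifies : ∀ {n m} → Queries n m → Fin n → Set
CIdentifies F d = ∀ y → (∀ i → d ∈ F i → y ∈ F i) → y ≡ d

-- Player D (given the NO sets {F ∈ 𝓕 : d ∉ F}) identifies d iff d is
-- the unique element lying in no set given to D.
DIdentifies : ∀ {n m} → Queries n m → Fin n → Set
DIdentifies F d = ∀ y → (∀ i → d ∉ F i → y ∉ F i) → y ≡ d

SolvesModel1 : ∀ {n m} → Queries n m → Set
SolvesModel1 {n} F = (d : Fin n) → CIdentifies F d ⊎ DIdentifies F d

-- Dual family: H x = {F ∈ 𝓕 : x ∈ F}, as a subset of the index set Fin m.
dual : ∀ {n m} → Queries n m → Fin n → Subset m
dual F x = tabulate (λ i → lookup (F i) x)

Is2SpernerOfCardX : ∀ {n m} → (Fin n → Subset m) → Set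
Is2SpernerOfCardX {n} H =
  (∀ x y → H x ≡ H y → x ≡ y) ×
  ¬ (Σ (Fin n) λ x → Σ (Fin n) λ y → Σ (Fin n) λ z →
       x ≢ y × y ≢ z × x ≢ z × H x ⊂ H y × H y ⊂ H z)

IsLeast : (ℕ → Set) → ℕ → Set
IsLeast P M = P M × (∀ m → P m → M ≤ m)

Model1Solvable : ℕ → ℕ → Set
Model1Solvable n m = Σ (Queries n m) λ F → IsFamily F × SolvesModel1 F

-- The binomial condition C(m,⌊m/2⌋) + C(m,⌊m/2+1⌋) ≥ n
-- (note ⌊m/2 + 1⌋ = ⌊m/2⌋ + 1).
BinomCond : ℕ → ℕ → Set
BinomCond n m = n ≤ (m C (m / 2)) + (m C (m / 2 + 1))

-- Player C identifies d iff H d is contained in no other H y, and Player D iff H d contains no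
-- other H y; so 𝓕 solves Model 1 iff every H d is maximal or minimal, i.e. iff the H x are
-- distinct and contain no chain H x ⊂ H y ⊂ H z.
--
-- Such a family in the cube of subsets of an m-set has at most C(m,⌊m/2⌋) + C(m,⌊m/2⌋+1)
-- members: the cube is partitioned into symmetric chains (de Bruijn, van Ebbenhorst Tengbergen
-- and Kruyswijk), and each chain of length ℓ contains at most min(2, ℓ) members of the family but
-- at least min(2, ℓ) sets of the two middle layers. The two middle layers themselves are such a
-- family, so they provide queries; when m is least possible no two of these queries coincide,
-- since deleting a duplicated coordinate would fit the family into a cube of dimension m - 1.

module Submission where

open import Defs
open import Data.Bool using (true; false)
import Data.Bool as Bool
open import Data.Empty using (⊥; ⊥-elim)
open import Data.Fin as Fin using (Fin)
import Data.Fin.Properties as Finₚ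
open import Data.Fin.Subset using (Subset; inside; outside; _∈_; _⊆_; _⊂_; ∣_∣)
open import Data.Fin.Subset.Properties
  using (_∈?_; _⊆?_; ⊆-refl; ⊆-reflexive; ⊆-antisym; s⊆s; out⊆; ⊂-trans; ⊂-irref; p⊂q⇒∣p∣<∣q∣)
open import Data.List as List using (List; []; _∷_; _++_; map; concat; concatMap; filter; length)
open import Data.List.Properties
  using (filter-++; filter-accept; filter-none; filter-≐; length-++; length-filter; ++-assoc; map-++)
open import Data.List.Membership.Propositional using () renaming (_∈_ to _∈ˡ_)
open import Data.List.Membership.Propositional.Properties
  using (∈-filter⁺; ∈-filter⁻; ∈-lookup; ∈-++⁺ˡ; ∈-++⁺ʳ; ∈-map⁺; ∈-map⁻)
import Data.List.Membership.Setoid.Properties as Membershipₛ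
open import Data.List.Relation.Unary.Any using (here; there)
open import Data.List.Relation.Unary.All as All using (All; []; _∷_)
import Data.List.Relation.Unary.All.Properties as Allₚ
open import Data.List.Relation.Unary.Linked as Linked using (Linked; []; [-]; _∷_)
import Data.List.Relation.Unary.Linked.Properties as Linkedₚ
open import Data.List.Relation.Unary.AllPairs using ([]; _∷_)
open import Data.List.Relation.Unary.Unique.Propositional using (Unique)
import Data.List.Relation.Unary.Unique.Propositional.Properties as Uniqueₚ
open import Data.List.Relation.Binary.Permutation.Propositional
  using (_↭_; ↭-refl; ↭-sym; ↭-trans; prep; module PermutationReasoning)
open import Data.List.Relation.Binary.Permutation.Propositional.Properties
  using (shift; shifts; ++⁺; ++⁺ˡ; map⁺; filter-↭; ↭-length; ∈-resp-↭)
open import Data.Nat as ℕ using (ℕ; zero; suc; _+_; _⊓_; _≤_; z≤n; s≤s; z<s; _/_; ⌊_/2⌋)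
open import Data.Nat.Properties
open import Data.Nat.DivMod using (m/n≡1+[m∸n]/n)
open import Data.Nat.Combinatorics using (_C_; nCk+nC[k+1]≡[n+1]C[k+1])
open import Data.Product using (∃; _×_; _,_; proj₁; proj₂)
open import Data.Sum as Sum using (_⊎_; inj₁; inj₂)
open import Data.Unit using (⊤; tt)
open import Data.Vec using ([]; _∷_; lookup; removeAt)
open import Data.Vec.Properties
  using (∷-injectiveʳ; ≡-dec; []=⇒lookup; lookup⇒[]=; lookup∘tabulate; tabulate∘lookup; tabulate-cong; removeAt-punchOut)
open import Function using (_∘_; const)
open import Function.Bundles using (_⇔_; mk⇔; Equivalence)
import Function.Properties.Equivalence as ⇔
open import Function.Definitions using (Injective)
open import Level using (Level)
open import Relation.Binary using (Rel; Transitive)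
open import Relation.Binary.PropositionalEquality
open import Relation.Nullary using (¬_; does; yes; no; contradiction)
open import Relation.Nullary.Decidable using (_⊎-dec_; _→-dec_; decidable-stable)
open import Relation.Unary using (Pred; Decidable)

private
  variable
    a p q r : Level
    A B : Set a
    n m : ℕ

¬∀⟶∃×¬ : {P Q : Pred (Fin n) p} → Decidable P → Decidable Q →
         ¬ (∀ y → P y → Q y) → ∃ λ y → P y × ¬ Q y
¬∀⟶∃×¬ {n} P? Q? ¬∀ with y , ¬[P→Q] ← Finₚ.¬∀⟶∃¬ n _ (λ y → P? y →-dec Q? y) ¬∀ =
  y , decidable-stable (P? y) (λ ¬Py → ¬[P→Q] (λ Py → contradiction Py ¬Py)) , ¬[P→Q] ∘ const

⊆∧≢⇒⊂ : {s t : Subset m} → s ⊆ t → s ≢ t → s ⊂ t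
⊆∧≢⇒⊂ {s = s} {t} s⊆t s≢t
  with x , x∈t , x∉s ← ¬∀⟶∃×¬ (_∈? t) (_∈? s) (λ t⊆s → s≢t (⊆-antisym s⊆t (t⊆s _)))
  = s⊆t , x , x∈t , x∉s

length-filter-++ : {P : Pred A p} (P? : Decidable P) → ∀ xs ys →
  length (filter P? (xs ++ ys)) ≡ length (filter P? xs) + length (filter P? ys)
length-filter-++ P? xs ys = trans (cong length (filter-++ P? xs ys)) (length-++ (filter P? xs))

length-filter-map : {P : Pred A p} (P? : Decidable P) (f : B → A) → ∀ xs →
  length (filter P? (map f xs)) ≡ length (filter (P? ∘ f) xs)
length-filter-map P? f [] = refl
length-filter-map P? f (x ∷ xs) with does (P? (f x))
... | true  = cong suc (length-filter-map P? f xs)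
... | false = length-filter-map P? f xs

length-filter-∷ : {P : Pred A p} (P? : Decidable P) (x : A) → ∀ xs →
  length (filter P? xs) ≤ length (filter P? (x ∷ xs))
length-filter-∷ P? x xs with does (P? x)
... | true  = n≤1+n _
... | false = ≤-refl

length-filter-⊎ : {P : Pred A p} {Q : Pred A q} (P? : Decidable P) (Q? : Decidable Q) →
  (∀ {x} → P x → ¬ Q x) → ∀ xs →
  length (filter (λ x → P? x ⊎-dec Q? x) xs) ≡ length (filter P? xs) + length (filter Q? xs)
length-filter-⊎ P? Q? disjoint [] = refl
length-filter-⊎ P? Q? disjoint (x ∷ xs) with P? x | Q? x
... | yes Px | yes Qx = contradiction Qx (disjoint Px)
... | yes _  | no _   = cong suc (length-filter-⊎ P? Q? disjoint xs)
... | no _   | yes _  = trans (cong suc (length-filter-⊎ P? Q? disjoint xs)) (sym (+-suc _ _))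
... | no _   | no _   = length-filter-⊎ P? Q? disjoint xs

length-filter-concat-mono : {P : Pred A p} {Q : Pred A q} (P? : Decidable P) (Q? : Decidable Q) →
  (xss : List (List A)) → (∀ {xs} → xs ∈ˡ xss → length (filter P? xs) ≤ length (filter Q? xs)) →
  length (filter P? (concat xss)) ≤ length (filter Q? (concat xss))
length-filter-concat-mono P? Q? [] _ = z≤n
length-filter-concat-mono P? Q? (xs ∷ xss) P≤Q = begin
  length (filter P? (xs ++ concat xss))                   ≡⟨ length-filter-++ P? xs (concat xss) ⟩
  length (filter P? xs) + length (filter P? (concat xss))
    ≤⟨ +-mono-≤ (P≤Q (here refl)) (length-filter-concat-mono P? Q? xss (P≤Q ∘ there)) ⟩
  length (filter Q? xs) + length (filter Q? (concat xss)) ≡⟨ length-filter-++ Q? xs (concat xss) ⟨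
  length (filter Q? (xs ++ concat xss))                   ∎
  where open ≤-Reasoning

length-filter-linked≤2 : {P : Pred A p} (P? : Decidable P) {R : Rel A r} → Transitive R →
  (∀ {x y z} → P x → P y → P z → R x y → R y z → ⊥) →
  ∀ {xs} → Linked R xs → length (filter P? xs) ≤ 2
length-filter-linked≤2 {P = P} P? {R} R-trans no-chain {xs} linked =
  short (Linkedₚ.filter⁺ P? R-trans linked) (Allₚ.all-filter P? xs)
  where
  short : ∀ {ys} → Linked R ys → All P ys → length ys ≤ 2
  short []              _                  = z≤n
  short [-]             _                  = s≤s z≤n
  short (_ ∷ [-])       _                  = s≤s (s≤s z≤n)
  short (xRy ∷ yRz ∷ _) (Px ∷ Py ∷ Pz ∷ _) = ⊥-elim (no-chain Px Py Pz xRy yRz)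

injective⇒≤length : {f : Fin n → A} {xs : List A} → Injective _≡_ _≡_ f → (∀ i → f i ∈ˡ xs) → n ≤ length xs
injective⇒≤length {A = A} f-injective f∈xs =
  Finₚ.injective⇒≤ λ {i} {j} same-index →
    f-injective (Membershipₛ.index-injective (setoid A) (f∈xs i) (f∈xs j) same-index)

Unique⇒lookup-injective : ∀ {xs : List A} → Unique xs → Injective _≡_ _≡_ (List.lookup xs)
Unique⇒lookup-injective {xs = x ∷ xs} (_ ∷ _) {Fin.zero} {Fin.zero} _ = refl
Unique⇒lookup-injective {xs = x ∷ xs} (x∉xs ∷ _) {Fin.zero} {Fin.suc j} eq = contradiction eq (All.lookup x∉xs (∈-lookup j))
Unique⇒lookup-injective {xs = x ∷ xs} (x∉xs ∷ _) {Fin.suc i} {Fin.zero} eq = contradiction (sym eq) (All.lookup x∉xs (∈-lookup i))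
Unique⇒lookup-injective {xs = x ∷ xs} (_ ∷ unique) {Fin.suc i} {Fin.suc j} eq = cong Fin.suc (Unique⇒lookup-injective unique eq)

-- The dual family

Maximal Minimal : (Fin n → Subset m) → Fin n → Set
Maximal H d = ∀ y → H d ⊆ H y → y ≡ d
Minimal H d = ∀ y → H y ⊆ H d → y ≡ d

Chain₃Free : (Fin n → Subset m) → Set
Chain₃Free H = ∀ {x y z} → H x ⊂ H y → H y ⊂ H z → ⊥

Sperner₂ : (Fin n → Subset m) → Set
Sperner₂ H = Injective _≡_ _≡_ H × Chain₃Free H

module _ (F : Queries n m) where

  ∈-dual⁺ : ∀ {x i} → x ∈ F i → i ∈ dual F x
  ∈-dual⁺ {x} {i} x∈Fi = lookup⇒[]= i (dual F x) (trans (lookup∘tabulate _ i) ([]=⇒lookup x∈Fi))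

  ∈-dual⁻ : ∀ {x i} → i ∈ dual F x → x ∈ F i
  ∈-dual⁻ {x} {i} i∈Hx = lookup⇒[]= x (F i) (trans (sym (lookup∘tabulate _ i)) ([]=⇒lookup i∈Hx))

  CIdentifies⇔Maximal : ∀ {d} → CIdentifies F d ⇔ Maximal (dual F) d
  CIdentifies⇔Maximal = mk⇔
    (λ identifies y Hd⊆Hy → identifies y λ i d∈Fi → ∈-dual⁻ (Hd⊆Hy (∈-dual⁺ d∈Fi)))
    (λ maximal y d∈⇒y∈ → maximal y λ {i} i∈Hd → ∈-dual⁺ (d∈⇒y∈ i (∈-dual⁻ i∈Hd)))

  DIdentifies⇔Minimal : ∀ {d} → DIdentifies F d ⇔ Minimal (dual F) d
  DIdentifies⇔Minimal {d} = mk⇔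
    (λ identifies y Hy⊆Hd → identifies y λ i d∉Fi y∈Fi → d∉Fi (∈-dual⁻ (Hy⊆Hd (∈-dual⁺ y∈Fi))))
    (λ minimal y d∉⇒y∉ → minimal y λ {i} i∈Hy →
      ∈-dual⁺ (decidable-stable (d ∈? F i) (λ d∉Fi → d∉⇒y∉ i d∉Fi (∈-dual⁻ i∈Hy))))

module _ {H : Fin n → Subset m} where

  Is2SpernerOfCardX⇔Sperner₂ : Is2SpernerOfCardX H ⇔ Sperner₂ H
  Is2SpernerOfCardX⇔Sperner₂ = mk⇔
    (λ (injective , no-chain) →
      (λ {x} {y} → injective x y) ,
      λ x⊂y y⊂z → no-chain (_ , _ , _ , distinct x⊂y , distinct y⊂z , distinct (⊂-trans x⊂y y⊂z) , x⊂y , y⊂z))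
    (λ (injective , chain₃Free) →
      (λ x y → injective) , λ (_ , _ , _ , _ , _ , _ , x⊂y , y⊂z) → chain₃Free x⊂y y⊂z)
    where
    distinct : ∀ {x y} → H x ⊂ H y → x ≢ y
    distinct Hx⊂Hy refl = ⊂-irref refl Hx⊂Hy

  maximal⊎minimal⇔Sperner₂ : (∀ d → Maximal H d ⊎ Minimal H d) ⇔ Sperner₂ H
  maximal⊎minimal⇔Sperner₂ = mk⇔ to from
    where
    to : (∀ d → Maximal H d ⊎ Minimal H d) → Sperner₂ H
    to extremal = injective , chain₃Free
      where
      injective : Injective _≡_ _≡_ H
      injective {x} {y} Hx≡Hy with extremal x
      ... | inj₁ maximal = sym (maximal y (⊆-reflexive Hx≡Hy))
      ... | inj₂ minimal = sym (minimal y (⊆-reflexive (sym Hx≡Hy)))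
      chain₃Free : Chain₃Free H
      chain₃Free {x} {y} {z} Hx⊂Hy Hy⊂Hz with extremal y
      ... | inj₁ maximal with refl ← maximal z (proj₁ Hy⊂Hz) = ⊂-irref refl Hy⊂Hz
      ... | inj₂ minimal with refl ← minimal x (proj₁ Hx⊂Hy) = ⊂-irref refl Hx⊂Hy

    from : Sperner₂ H → ∀ d → Maximal H d ⊎ Minimal H d
    from (injective , chain₃Free) d
      with Finₚ.all? (λ y → (H d ⊆? H y) →-dec (y Fin.≟ d)) | Finₚ.all? (λ y → (H y ⊆? H d) →-dec (y Fin.≟ d))
    ... | yes maximal | _           = inj₁ maximal
    ... | no _        | yes minimal = inj₂ minimal
    ... | no ¬maximal | no ¬minimal
      with y , Hd⊆Hy , y≢d ← ¬∀⟶∃×¬ (λ y → H d ⊆? H y) (λ y → y Fin.≟ d) ¬maximal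
         | z , Hz⊆Hd , z≢d ← ¬∀⟶∃×¬ (λ z → H z ⊆? H d) (λ z → z Fin.≟ d) ¬minimal
      = ⊥-elim (chain₃Free (⊆∧≢⇒⊂ Hz⊆Hd (z≢d ∘ injective)) (⊆∧≢⇒⊂ Hd⊆Hy (y≢d ∘ sym ∘ injective)))

solvesModel1⇔Sperner₂ : (F : Queries n m) → SolvesModel1 F ⇔ Sperner₂ (dual F)
solvesModel1⇔Sperner₂ F = mk⇔
  (λ solves → to maximal⊎minimal⇔Sperner₂ λ d →
    Sum.map (to (CIdentifies⇔Maximal F)) (to (DIdentifies⇔Minimal F)) (solves d))
  (λ sperner d →
    Sum.map (from (CIdentifies⇔Maximal F)) (from (DIdentifies⇔Minimal F)) (from maximal⊎minimal⇔Sperner₂ sperner d))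
  where open Equivalence

-- The cube and its two middle layers

subsets : ∀ m → List (Subset m)
subsets zero    = [] ∷ []
subsets (suc m) = map (outside ∷_) (subsets m) ++ map (inside ∷_) (subsets m)

∈-subsets : (s : Subset m) → s ∈ˡ subsets m
∈-subsets []            = here refl
∈-subsets (outside ∷ s) = ∈-++⁺ˡ (∈-map⁺ (outside ∷_) (∈-subsets s))
∈-subsets (inside ∷ s)  = ∈-++⁺ʳ _ (∈-map⁺ (inside ∷_) (∈-subsets s))

subsets-unique : ∀ m → Unique (subsets m)
subsets-unique zero    = [] ∷ []
subsets-unique (suc m) =
  Uniqueₚ.++⁺ (Uniqueₚ.map⁺ ∷-injectiveʳ (subsets-unique m)) (Uniqueₚ.map⁺ ∷-injectiveʳ (subsets-unique m))
              outside≢inside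
  where
  outside≢inside : ∀ {s} → ¬ (s ∈ˡ map (outside ∷_) (subsets m) × s ∈ˡ map (inside ∷_) (subsets m))
  outside≢inside (s∈outer , s∈inner)
    with _ , _ , refl ← ∈-map⁻ (outside ∷_) s∈outer | _ , _ , () ← ∈-map⁻ (inside ∷_) s∈inner

level? : ∀ k → Decidable {A = Subset m} (λ s → ∣ s ∣ ≡ k)
level? k s = ∣ s ∣ ℕ.≟ k

-- ∣ outside ∷ s ∣ reduces to ∣ s ∣, so level? k ∘ (outside ∷_) is level? k.
length-level-suc : ∀ m k → length (filter (level? k) (subsets (suc m))) ≡
  length (filter (level? k) (subsets m)) + length (filter (level? k ∘ (inside ∷_)) (subsets m))
length-level-suc m k = begin
  length (filter (level? k) (map (outside ∷_) (subsets m) ++ map (inside ∷_) (subsets m)))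
    ≡⟨ length-filter-++ (level? k) (map (outside ∷_) (subsets m)) _ ⟩
  length (filter (level? k) (map (outside ∷_) (subsets m))) + length (filter (level? k) (map (inside ∷_) (subsets m)))
    ≡⟨ cong₂ _+_ (length-filter-map (level? k) (outside ∷_) (subsets m)) (length-filter-map (level? k) (inside ∷_) (subsets m)) ⟩
  length (filter (level? k) (subsets m)) + length (filter (level? k ∘ (inside ∷_)) (subsets m))
    ∎
  where open ≡-Reasoning

length-level : ∀ m k → length (filter (level? k) (subsets m)) ≡ m C k
length-level zero    zero    = refl
length-level zero    (suc k) = refl
length-level (suc m) zero    = begin
  length (filter (level? 0) (subsets (suc m)))                                                  ≡⟨ length-level-suc m 0 ⟩
  length (filter (level? 0) (subsets m)) + length (filter (level? 0 ∘ (inside ∷_)) (subsets m)) ≡⟨ cong₂ _+_ (length-level m 0) none ⟩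
  m C 0 + 0                                                                                     ∎
  where
  open ≡-Reasoning
  none : length (filter (level? 0 ∘ (inside ∷_)) (subsets m)) ≡ 0
  none = cong length (filter-none (level? 0 ∘ (inside ∷_)) (All.universal (λ _ ()) (subsets m)))
length-level (suc m) (suc k) = begin
  length (filter (level? (suc k)) (subsets (suc m)))  ≡⟨ length-level-suc m (suc k) ⟩
  length (filter (level? (suc k)) (subsets m)) + length (filter (level? (suc k) ∘ (inside ∷_)) (subsets m))
                                                      ≡⟨ cong (length (filter (level? (suc k)) (subsets m)) +_) (cong length drop-inside) ⟩
  length (filter (level? (suc k)) (subsets m)) + length (filter (level? k) (subsets m))
                                                      ≡⟨ cong₂ _+_ (length-level m (suc k)) (length-level m k) ⟩
  m C suc k + m C k                                   ≡⟨ +-comm (m C suc k) (m C k) ⟩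
  m C k + m C suc k                                   ≡⟨ nCk+nC[k+1]≡[n+1]C[k+1] m k ⟩
  suc m C suc k                                       ∎
  where
  open ≡-Reasoning
  drop-inside : filter (level? (suc k) ∘ (inside ∷_)) (subsets m) ≡ filter (level? k) (subsets m)
  drop-inside = filter-≐ (level? (suc k) ∘ (inside ∷_)) (level? k) (suc-injective , cong suc) (subsets m)

Middle : ℕ → Subset m → Set
Middle k s = ∣ s ∣ ≡ k ⊎ ∣ s ∣ ≡ suc k

middle? : ∀ k → Decidable (Middle {m} k)
middle? k s = level? k s ⊎-dec level? (suc k) s

middleLayers : ∀ m → List (Subset m)
middleLayers m = filter (middle? ⌊ m /2⌋) (subsets m)

m/2≡⌊m/2⌋ : ∀ m → m / 2 ≡ ⌊ m /2⌋
m/2≡⌊m/2⌋ zero          = refl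
m/2≡⌊m/2⌋ (suc zero)    = refl
m/2≡⌊m/2⌋ (suc (suc m)) = trans (m/n≡1+[m∸n]/n {suc (suc m)} (s≤s (s≤s z≤n))) (cong suc (m/2≡⌊m/2⌋ m))

length-middleLayers : ∀ m → length (middleLayers m) ≡ m C (m / 2) + m C (m / 2 + 1)
length-middleLayers m = begin
  length (middleLayers m)                    ≡⟨ length-filter-⊎ (level? k) (level? (suc k)) (λ {s} → disjoint {s}) (subsets m) ⟩
  length (filter (level? k) (subsets m)) + length (filter (level? (suc k)) (subsets m))
                                             ≡⟨ cong₂ _+_ (length-level m k) (length-level m (suc k)) ⟩
  m C k + m C suc k                          ≡⟨ cong (λ h → m C h + m C suc h) (m/2≡⌊m/2⌋ m) ⟨
  m C (m / 2) + m C suc (m / 2)              ≡⟨ cong (λ h → m C (m / 2) + m C h) (+-comm 1 (m / 2)) ⟩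
  m C (m / 2) + m C (m / 2 + 1)              ∎
  where
  open ≡-Reasoning
  k : ℕ
  k = ⌊ m /2⌋
  disjoint : ∀ {s : Subset m} → ∣ s ∣ ≡ k → ∣ s ∣ ≢ suc k
  disjoint ∣s∣≡k ∣s∣≡1+k = 1+n≢n (trans (sym ∣s∣≡1+k) ∣s∣≡k)

-- Symmetric chains

_⋖_ : Subset m → Subset m → Set
s ⋖ t = s ⊆ t × ∣ t ∣ ≡ suc ∣ s ∣

⋖⇒⊂ : {s t : Subset m} → s ⋖ t → s ⊂ t
⋖⇒⊂ (s⊆t , ∣t∣≡1+∣s∣) = ⊆∧≢⇒⊂ s⊆t λ { refl → 1+n≢n (sym ∣t∣≡1+∣s∣) }

-- The levels of s ∷ ss run from ∣ s ∣ to ∣ s ∣ + length ss; bottom + top = m.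
SymmetricChain : ∀ m → List (Subset m) → Set
SymmetricChain m []       = ⊤
SymmetricChain m (s ∷ ss) = Linked _⋖_ (s ∷ ss) × ∣ s ∣ + (∣ s ∣ + length ss) ≡ m

SymmetricChain⇒Linked : ∀ {ss} → SymmetricChain m ss → Linked _⋖_ ss
SymmetricChain⇒Linked {ss = []}    _            = []
SymmetricChain⇒Linked {ss = _ ∷ _} (linked , _) = linked

-- split turns s₀ ⋖ … ⋖ sᵣ into 0s₀ ⋖ … ⋖ 0sᵣ ⋖ 1sᵣ and 1s₀ ⋖ … ⋖ 1sᵣ₋₁;
-- upperTail s ss is the first of these without its head.
upperTail lower : Subset m → List (Subset m) → List (Subset (suc m))
upperTail s []       = (inside ∷ s) ∷ []
upperTail s (t ∷ ts) = (outside ∷ t) ∷ upperTail t ts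
lower s []       = []
lower s (t ∷ ts) = (inside ∷ s) ∷ lower t ts

split : List (Subset m) → List (List (Subset (suc m)))
split []       = []
split (s ∷ ss) = ((outside ∷ s) ∷ upperTail s ss) ∷ lower s ss ∷ []

chains : ∀ m → List (List (Subset m))
chains zero    = ([] ∷ []) ∷ []
chains (suc m) = concatMap split (chains m)

split↭ : (s : Subset m) (ss : List (Subset m)) →
  upperTail s ss ++ lower s ss ↭ map (outside ∷_) ss ++ map (inside ∷_) (s ∷ ss)
split↭ s []       = ↭-refl
split↭ s (t ∷ ts) = prep (outside ∷ t) (begin
  upperTail t ts ++ (inside ∷ s) ∷ lower t ts            ↭⟨ shift (inside ∷ s) (upperTail t ts) (lower t ts) ⟩
  (inside ∷ s) ∷ (upperTail t ts ++ lower t ts)          ↭⟨ prep (inside ∷ s) (split↭ t ts) ⟩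
  (inside ∷ s) ∷ (map (outside ∷_) ts ++ map (inside ∷_) (t ∷ ts)) ↭⟨ shift (inside ∷ s) (map (outside ∷_) ts) _ ⟨
  map (outside ∷_) ts ++ (inside ∷ s) ∷ map (inside ∷_) (t ∷ ts) ∎)
  where open PermutationReasoning

concat-split↭ : (sss : List (List (Subset m))) →
  concat (concatMap split sss) ↭ map (outside ∷_) (concat sss) ++ map (inside ∷_) (concat sss)
concat-split↭ []               = ↭-refl
concat-split↭ ([] ∷ sss)       = concat-split↭ sss
concat-split↭ ((s ∷ ss) ∷ sss) = begin
  ((outside ∷ s) ∷ upperTail s ss) ++ (lower s ss ++ rest)  ≡⟨ ++-assoc ((outside ∷ s) ∷ upperTail s ss) (lower s ss) rest ⟨
  ((outside ∷ s) ∷ upperTail s ss ++ lower s ss) ++ rest    ↭⟨ ++⁺ (prep (outside ∷ s) (split↭ s ss)) (concat-split↭ sss) ⟩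
  (O (s ∷ ss) ++ I (s ∷ ss)) ++ (O (concat sss) ++ I (concat sss))
    ≡⟨ ++-assoc (O (s ∷ ss)) (I (s ∷ ss)) _ ⟩
  O (s ∷ ss) ++ (I (s ∷ ss) ++ (O (concat sss) ++ I (concat sss)))
    ↭⟨ ++⁺ˡ (O (s ∷ ss)) (shifts (I (s ∷ ss)) (O (concat sss))) ⟩
  O (s ∷ ss) ++ (O (concat sss) ++ (I (s ∷ ss) ++ I (concat sss)))
    ≡⟨ ++-assoc (O (s ∷ ss)) (O (concat sss)) _ ⟨
  (O (s ∷ ss) ++ O (concat sss)) ++ (I (s ∷ ss) ++ I (concat sss))
    ≡⟨ cong₂ _++_ (map-++ (outside ∷_) (s ∷ ss) (concat sss)) (map-++ (inside ∷_) (s ∷ ss) (concat sss)) ⟨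
  O ((s ∷ ss) ++ concat sss) ++ I ((s ∷ ss) ++ concat sss) ∎
  where
  open PermutationReasoning
  rest : List (Subset (suc _))
  rest = concat (concatMap split sss)
  O I : List (Subset _) → List (Subset (suc _))
  O = map (outside ∷_)
  I = map (inside ∷_)

concat-chains↭subsets : ∀ m → concat (chains m) ↭ subsets m
concat-chains↭subsets zero    = ↭-refl
concat-chains↭subsets (suc m) = ↭-trans (concat-split↭ (chains m))
  (++⁺ (map⁺ (outside ∷_) (concat-chains↭subsets m)) (map⁺ (inside ∷_) (concat-chains↭subsets m)))

∈-chains : (s : Subset m) → s ∈ˡ concat (chains m)
∈-chains s = ∈-resp-↭ (↭-sym (concat-chains↭subsets _)) (∈-subsets s)

length-upperTail : (s : Subset m) → ∀ ss → length (upperTail s ss) ≡ suc (length ss)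
length-upperTail s []       = refl
length-upperTail s (t ∷ ts) = cong suc (length-upperTail t ts)

length-lower : (s : Subset m) → ∀ ss → length (lower s ss) ≡ length ss
length-lower s []       = refl
length-lower s (t ∷ ts) = cong suc (length-lower t ts)

upper-linked : ∀ {s : Subset m} {ss} → Linked _⋖_ (s ∷ ss) → Linked _⋖_ ((outside ∷ s) ∷ upperTail s ss)
upper-linked [-]                = (out⊆ ⊆-refl , refl) ∷ [-]
upper-linked ((s⊆t , e) ∷ linked) = (s⊆s s⊆t , e) ∷ upper-linked linked

lower-linked : ∀ {s : Subset m} {ss} → Linked _⋖_ (s ∷ ss) → Linked _⋖_ (lower s ss)
lower-linked [-]                           = []
lower-linked (_ ∷ [-])                     = [-]
lower-linked ((s⊆t , e) ∷ linked@(_ ∷ _)) = (s⊆s s⊆t , cong suc e) ∷ lower-linked linked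

bottom+top-suc : ∀ a l → a + (a + suc l) ≡ suc (a + (a + l))
bottom+top-suc a l = trans (cong (a +_) (+-suc a l)) (+-suc a (a + l))

split-symmetric : ∀ {ss} → SymmetricChain m ss → All (SymmetricChain (suc m)) (split ss)
split-symmetric {ss = []} _ = []
split-symmetric {ss = s ∷ ss} (linked , levels) = upper ∷ lower-symmetric ss linked levels ∷ []
  where
  upper : SymmetricChain _ ((outside ∷ s) ∷ upperTail s ss)
  upper = upper-linked linked , (begin
    ∣ s ∣ + (∣ s ∣ + length (upperTail s ss)) ≡⟨ cong (λ l → ∣ s ∣ + (∣ s ∣ + l)) (length-upperTail s ss) ⟩
    ∣ s ∣ + (∣ s ∣ + suc (length ss))         ≡⟨ bottom+top-suc ∣ s ∣ (length ss) ⟩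
    suc (∣ s ∣ + (∣ s ∣ + length ss))         ≡⟨ cong suc levels ⟩
    suc _                                     ∎)
    where open ≡-Reasoning
  lower-symmetric : ∀ ss → Linked _⋖_ (s ∷ ss) → ∣ s ∣ + (∣ s ∣ + length ss) ≡ _ → SymmetricChain _ (lower s ss)
  lower-symmetric []       _      _      = tt
  lower-symmetric (t ∷ ts) linked levels = lower-linked linked , cong suc (begin
    ∣ s ∣ + suc (∣ s ∣ + length (lower t ts)) ≡⟨ cong (λ l → ∣ s ∣ + suc (∣ s ∣ + l)) (length-lower t ts) ⟩
    ∣ s ∣ + suc (∣ s ∣ + length ts)           ≡⟨ +-suc ∣ s ∣ (∣ s ∣ + length ts) ⟩
    suc (∣ s ∣ + (∣ s ∣ + length ts))         ≡⟨ bottom+top-suc ∣ s ∣ (length ts) ⟨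
    ∣ s ∣ + (∣ s ∣ + suc (length ts))         ≡⟨ levels ⟩
    _                                         ∎)
    where open ≡-Reasoning

chains-symmetric : ∀ m → All (SymmetricChain m) (chains m)
chains-symmetric zero    = ([-] , refl) ∷ []
chains-symmetric (suc m) = concatMap-symmetric (chains-symmetric m)
  where
  concatMap-symmetric : ∀ {sss} → All (SymmetricChain m) sss → All (SymmetricChain (suc m)) (concatMap split sss)
  concatMap-symmetric []                  = []
  concatMap-symmetric (symmetric ∷ rest) = Allₚ.++⁺ (split-symmetric symmetric) (concatMap-symmetric rest)

middle-count-bottom : ∀ {s : Subset m} {ss} → Linked _⋖_ (s ∷ ss) →
  2 ⊓ length (s ∷ ss) ≤ length (filter (middle? ∣ s ∣) (s ∷ ss))
middle-count-bottom {s = s} [-] rewrite filter-accept (middle? ∣ s ∣) {x = s} {xs = []} (inj₁ refl) = s≤s z≤n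
middle-count-bottom {s = s} {t ∷ ts} ((_ , ∣t∣≡1+∣s∣) ∷ _)
  rewrite filter-accept (middle? ∣ s ∣) {x = s} {xs = t ∷ ts} (inj₁ refl)
        | filter-accept (middle? ∣ s ∣) {x = t} {xs = ts} (inj₂ ∣t∣≡1+∣s∣) = s≤s (s≤s z≤n)

middle-count : ∀ {k j} {s : Subset m} {ss} → Linked _⋖_ (s ∷ ss) → j ≤ 2 → ∣ s ∣ ≤ k →
  k + j ≤ ∣ s ∣ + length (s ∷ ss) → j ≤ length (filter (middle? k) (s ∷ ss))
middle-count {j = zero} _ _ _ _ = z≤n
middle-count {k = k} {suc j} {s = s} linked j≤2 ∣s∣≤k bound with m≤n⇒m<n∨m≡n ∣s∣≤k
... | inj₂ refl = ≤-trans (⊓-glb j≤2 (+-cancelˡ-≤ ∣ s ∣ _ _ bound)) (middle-count-bottom linked)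
middle-count {k = k} {suc j} {s = s} [-] _ _ bound | inj₁ ∣s∣<k =
  contradiction bound (<⇒≱ (≤-<-trans (subst (_≤ k) (+-comm 1 ∣ s ∣) ∣s∣<k) (m<m+n k z<s)))
middle-count {k = k} {suc j} {s = s} {t ∷ ts} ((_ , ∣t∣≡1+∣s∣) ∷ linked) j≤2 _ bound | inj₁ ∣s∣<k =
  ≤-trans (middle-count linked j≤2 (subst (_≤ k) (sym ∣t∣≡1+∣s∣) ∣s∣<k) (subst (k + suc j ≤_) shift-bottom bound))
          (length-filter-∷ (middle? k) s (t ∷ ts))
  where
  shift-bottom : ∣ s ∣ + suc (suc (length ts)) ≡ ∣ t ∣ + suc (length ts)
  shift-bottom = trans (+-suc ∣ s ∣ _) (cong (_+ suc (length ts)) (sym ∣t∣≡1+∣s∣))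

⌊n/2⌋+2⊓[1+n]≤1+n : ∀ n → ⌊ n /2⌋ + 2 ⊓ suc n ≤ suc n
⌊n/2⌋+2⊓[1+n]≤1+n zero          = ≤-refl
⌊n/2⌋+2⊓[1+n]≤1+n (suc zero)    = ≤-refl
⌊n/2⌋+2⊓[1+n]≤1+n (suc (suc n)) = s≤s (begin
  ⌊ n /2⌋ + 2 ≡⟨ +-comm ⌊ n /2⌋ 2 ⟩
  2 + ⌊ n /2⌋ ≤⟨ +-monoʳ-≤ 2 (⌊n/2⌋≤n n) ⟩
  2 + n       ∎)
  where open ≤-Reasoning

-- A symmetric chain from level a of length 1 + l meets level ⌊ m /2⌋, and also the level above unless l = 0.
symmetric-levels : ∀ a l m → a + (a + l) ≡ m → a ≤ ⌊ m /2⌋ × ⌊ m /2⌋ + 2 ⊓ suc l ≤ a + suc l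
symmetric-levels zero    l .l refl = z≤n , ⌊n/2⌋+2⊓[1+n]≤1+n l
symmetric-levels (suc a) l zero ()
symmetric-levels (suc a) l (suc zero) levels = contradiction (trans (sym (+-suc a (a + l))) (suc-injective levels)) λ ()
symmetric-levels (suc a) l (suc (suc m)) levels
  with a≤⌊m/2⌋ , bound ← symmetric-levels a l m (suc-injective (trans (sym (+-suc a (a + l))) (suc-injective levels)))
  = s≤s a≤⌊m/2⌋ , s≤s bound

middle-count-symmetric : ∀ {ss} → SymmetricChain m ss → 2 ⊓ length ss ≤ length (filter (middle? ⌊ m /2⌋) ss)
middle-count-symmetric {ss = []} _ = z≤n
middle-count-symmetric {m} {s ∷ ss} (linked , levels)
  with ∣s∣≤⌊m/2⌋ , bound ← symmetric-levels ∣ s ∣ (length ss) m levels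
  = middle-count linked (m⊓n≤m 2 _) ∣s∣≤⌊m/2⌋ bound

-- The upper bound

Sperner₂⇒≤middleLayers : {H : Fin n → Subset m} → Sperner₂ H → n ≤ length (middleLayers m)
Sperner₂⇒≤middleLayers {n} {m} {H} (injective , chain₃Free) = begin
  n                                           ≤⟨ injective⇒≤length injective covered ⟩
  length (filter image? (concat (chains m)))  ≤⟨ length-filter-concat-mono image? (middle? k) (chains m) per-chain ⟩
  length (filter (middle? k) (concat (chains m))) ≡⟨ ↭-length (filter-↭ (middle? k) (concat-chains↭subsets m)) ⟩
  length (middleLayers m)                     ∎
  where
  open ≤-Reasoning
  k : ℕ
  k = ⌊ m /2⌋
  image? : Decidable (λ s → ∃ λ x → H x ≡ s)
  image? s = Finₚ.any? (λ x → ≡-dec Bool._≟_ (H x) s)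
  covered : ∀ x → H x ∈ˡ filter image? (concat (chains m))
  covered x = ∈-filter⁺ image? (∈-chains (H x)) (x , refl)
  per-chain : ∀ {ss} → ss ∈ˡ chains m → length (filter image? ss) ≤ length (filter (middle? k) ss)
  per-chain {ss} ss∈chains = ≤-trans
    (⊓-glb (length-filter-linked≤2 image? ⊂-trans (λ { (_ , refl) (_ , refl) (_ , refl) → chain₃Free })
                                   (Linked.map ⋖⇒⊂ (SymmetricChain⇒Linked symmetric)))
           (length-filter image? ss))
    (middle-count-symmetric symmetric)
    where
    symmetric : SymmetricChain m ss
    symmetric = All.lookup (chains-symmetric m) ss∈chains

Sperner₂⇒BinomCond : {H : Fin n → Subset m} → Sperner₂ H → BinomCond n m
Sperner₂⇒BinomCond {n} {m} sperner = subst (n ≤_) (length-middleLayers m) (Sperner₂⇒≤middleLayers sperner)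

-- The middle layers attain the bound

twoLayers⇒Chain₃Free : ∀ {k} {H : Fin n → Subset m} → (∀ x → Middle k (H x)) → Chain₃Free H
twoLayers⇒Chain₃Free {k = k} {H} middle {x} {y} {z} Hx⊂Hy Hy⊂Hz =
  <⇒≱ (≤-<-trans (≤-<-trans (bottom {s = H x} (middle x)) (p⊂q⇒∣p∣<∣q∣ Hx⊂Hy)) (p⊂q⇒∣p∣<∣q∣ Hy⊂Hz))
      (top {s = H z} (middle z))
  where
  bottom : ∀ {s : Subset m} → Middle k s → k ≤ ∣ s ∣
  bottom (inj₁ ∣s∣≡k)   = ≤-reflexive (sym ∣s∣≡k)
  bottom (inj₂ ∣s∣≡1+k) = ≤-trans (n≤1+n k) (≤-reflexive (sym ∣s∣≡1+k))
  top : ∀ {s : Subset m} → Middle k s → ∣ s ∣ ≤ suc k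
  top (inj₁ ∣s∣≡k)   = ≤-trans (≤-reflexive ∣s∣≡k) (n≤1+n k)
  top (inj₂ ∣s∣≡1+k) = ≤-reflexive ∣s∣≡1+k

middleFamily : n ≤ length (middleLayers m) → Fin n → Subset m
middleFamily {m = m} n≤ x = List.lookup (middleLayers m) (Fin.inject≤ x n≤)

middleFamily-Sperner₂ : (n≤ : n ≤ length (middleLayers m)) → Sperner₂ (middleFamily n≤)
middleFamily-Sperner₂ {m = m} n≤ =
  Finₚ.inject≤-injective n≤ n≤ _ _ ∘ Unique⇒lookup-injective (Uniqueₚ.filter⁺ (middle? ⌊ m /2⌋) (subsets-unique m)) ,
  twoLayers⇒Chain₃Free {H = middleFamily n≤}
    (λ x → proj₂ (∈-filter⁻ (middle? ⌊ m /2⌋) {xs = subsets m} (∈-lookup (Fin.inject≤ x n≤))))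

dual-involutive : (H : Fin n → Subset m) → ∀ x → dual (dual H) x ≡ H x
dual-involutive H x = trans (tabulate-cong λ i → lookup∘tabulate (λ y → lookup (H y) i) x) (tabulate∘lookup (H x))

Sperner₂-resp-≗ : {G H : Fin n → Subset m} → (∀ x → G x ≡ H x) → Sperner₂ H → Sperner₂ G
Sperner₂-resp-≗ G≗H (injective , chain₃Free) =
  (λ {x} {y} Gx≡Gy → injective (trans (sym (G≗H x)) (trans Gx≡Gy (G≗H y)))) ,
  λ {x} {y} {z} Gx⊂Gy Gy⊂Gz → chain₃Free (subst₂ _⊂_ (G≗H x) (G≗H y) Gx⊂Gy) (subst₂ _⊂_ (G≗H y) (G≗H z) Gy⊂Gz)

Sperner₂-reflect : ∀ {m′} {H : Fin n → Subset m} (f : Subset m → Subset m′) →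
  (∀ {x y} → f (H x) ⊆ f (H y) → H x ⊆ H y) → Sperner₂ H → Sperner₂ (f ∘ H)
Sperner₂-reflect {H = H} f reflects (injective , chain₃Free) =
  (λ fHx≡fHy → injective (⊆-antisym (reflects (⊆-reflexive fHx≡fHy)) (reflects (⊆-reflexive (sym fHx≡fHy))))) ,
  λ fHx⊂fHy fHy⊂fHz → chain₃Free (reflect-⊂ fHx⊂fHy) (reflect-⊂ fHy⊂fHz)
  where
  reflect-⊂ : ∀ {x y} → f (H x) ⊂ f (H y) → H x ⊂ H y
  reflect-⊂ fHx⊂fHy = ⊆∧≢⇒⊂ (reflects (proj₁ fHx⊂fHy)) (λ Hx≡Hy → ⊂-irref (cong f Hx≡Hy) fHx⊂fHy)

removeAt-⊆⇒∈ : {s t : Subset (suc m)} {j c : Fin (suc m)} → j ≢ c → removeAt s j ⊆ removeAt t j → c ∈ s → c ∈ t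
removeAt-⊆⇒∈ {s = s} {t} {c = c} j≢c s⊆t c∈s = lookup⇒[]= c t (begin
  lookup t c                                  ≡⟨ removeAt-punchOut t j≢c ⟨
  lookup (removeAt t _) (Fin.punchOut j≢c)    ≡⟨ []=⇒lookup (s⊆t (lookup⇒[]= _ _ (trans (removeAt-punchOut s j≢c) ([]=⇒lookup c∈s)))) ⟩
  inside                                      ∎)
  where open ≡-Reasoning

removeAt-⊆-reflect : {s t : Subset (suc m)} {i j : Fin (suc m)} → i ≢ j →
  lookup s i ≡ lookup s j → lookup t i ≡ lookup t j → removeAt s j ⊆ removeAt t j → s ⊆ t
removeAt-⊆-reflect {s = s} {t} {i} {j} i≢j sᵢ≡sⱼ tᵢ≡tⱼ s⊆t {c} c∈s with c Fin.≟ j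
... | no c≢j   = removeAt-⊆⇒∈ {s = s} {t} (c≢j ∘ sym) s⊆t c∈s
... | yes refl = lookup⇒[]= c t (trans (sym tᵢ≡tⱼ) ([]=⇒lookup (removeAt-⊆⇒∈ {s = s} {t} (i≢j ∘ sym) s⊆t i∈s)))
  where
  i∈s : i ∈ s
  i∈s = lookup⇒[]= i s (trans sᵢ≡sⱼ ([]=⇒lookup c∈s))

minimal⇒IsFamily-dual : ∀ {M} {H : Fin n → Subset M} → (∀ m → BinomCond n m → M ≤ m) → Sperner₂ H → IsFamily (dual H)
minimal⇒IsFamily-dual {M = zero} _ _ {()}
minimal⇒IsFamily-dual {M = suc m} {H} minimal sperner {i} {j} Fᵢ≡Fⱼ with i Fin.≟ j
... | yes i≡j = i≡j
... | no i≢j  = contradiction (minimal m (Sperner₂⇒BinomCond (Sperner₂-reflect (λ s → removeAt s j) reflects sperner))) 1+n≰n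
  where
  column : ∀ x → lookup (H x) i ≡ lookup (H x) j
  column x = trans (sym (lookup∘tabulate _ x)) (trans (cong (λ s → lookup s x) Fᵢ≡Fⱼ) (lookup∘tabulate _ x))
  reflects : ∀ {x y} → removeAt (H x) j ⊆ removeAt (H y) j → H x ⊆ H y
  reflects {x} {y} = removeAt-⊆-reflect {s = H x} {H y} i≢j (column x) (column y)

least⇒Model1Solvable : ∀ M → IsLeast (BinomCond n) M → Model1Solvable n M
least⇒Model1Solvable {n} M (bound , minimal) =
  dual H , minimal⇒IsFamily-dual minimal sperner ,
  Equivalence.from (solvesModel1⇔Sperner₂ (dual H)) (Sperner₂-resp-≗ (dual-involutive H) sperner)
  where
  n≤ : n ≤ length (middleLayers M)
  n≤ = subst (n ≤_) (sym (length-middleLayers M)) bound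
  H : Fin n → Subset M
  H = middleFamily n≤
  sperner : Sperner₂ H
  sperner = middleFamily-Sperner₂ n≤

proposition1 :
    (n : ℕ) → 2 ≤ n →
      ((m : ℕ) (F : Queries n m) → IsFamily F →
         SolvesModel1 F ⇔ Is2SpernerOfCardX (dual F))
      × ((M : ℕ) → IsLeast (BinomCond n) M → IsLeast (Model1Solvable n) M)
proposition1 n _ =
  (λ m F _ → ⇔.trans (solvesModel1⇔Sperner₂ F) (⇔.sym Is2SpernerOfCardX⇔Sperner₂)) ,
  λ M least@(_ , minimal) →
    least⇒Model1Solvable M least ,
    λ m (F , _ , solves) → minimal m (Sperner₂⇒BinomCond (Equivalence.to (solvesModel1⇔Sperner₂ F) solves))
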